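{- Let $(P,\leq)$ be the ordinal sum of an antichain $(A,\leq)$ and a finite chain $(C,\leq)$ (with $A\cap C=\emptyset$). Then every strictly monotone mapping $f\colon P\to P$ is strongly upper cone preserving.
   Context: The ordinal sum of disjoint posets $(A,\leq)$ and $(B,\leq)$ is the poset on $A\cup B$ whose order restricts to the original orders on $A$ and on $B$ and in which every element of $A$ is below every element of $B$. For $X\subseteq P$, $U(X)=\{x\in P\mid y\leq x\text{ for all }y\in X\}$ and $U(x,y)=U(\{x,y\})$. A mapping $f\colon P\to P$ is strictly monotone if $x<y$ implies $f(x)<f(y)$, and strongly upper cone preserving if $f(U(x,y))=U(f(x),f(y))$ for all $x,y\in P$ with $f(x)\neq f(y)$. -}

module Defs where

open import Level using (Level; Lift)
open import Data.Nat using (ℕ)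
open import Data.Fin using (Fin)
import Data.Fin as Fin
open import Data.Sum using (_⊎_; inj₁; inj₂)
open import Data.Product using (_×_; Σ)
open import Data.Empty using (⊥)
open import Data.Unit using (⊤)
open import Relation.Binary.PropositionalEquality using (_≡_)
open import Relation.Nullary using (¬_)

-- Carrier of the ordinal sum P = A ⊕ C of an antichain A (an arbitrary type,
-- ordered by equality only) and the finite chain C = Fin n (n elements,
-- ordered by the usual order of Fin n).  A and C are disjoint via the sum type.
OrdSum : ∀ {a} → Set a → ℕ → Set a
OrdSum A n = A ⊎ Fin n

_≤ₚ_ : ∀ {a} {A : Set a} {n : ℕ} → OrdSum A n → OrdSum A n → Set a
inj₁ x ≤ₚ inj₁ y = x ≡ y
inj₁ x ≤ₚ inj₂ j = Lift _ ⊤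
inj₂ i ≤ₚ inj₁ y = Lift _ ⊥
inj₂ i ≤ₚ inj₂ j = Lift _ (i Fin.≤ j)

_<ₚ_ : ∀ {a} {A : Set a} {n : ℕ} → OrdSum A n → OrdSum A n → Set a
x <ₚ y = (x ≤ₚ y) × ¬ (x ≡ y)

U₂ : ∀ {a} {A : Set a} {n : ℕ} → OrdSum A n → OrdSum A n → OrdSum A n → Set a
U₂ x y z = (x ≤ₚ z) × (y ≤ₚ z)

module _ {a} {A : Set a} {n : ℕ} where

  StrictlyMonotone : (OrdSum A n → OrdSum A n) → Set a
  StrictlyMonotone f = ∀ x y → x <ₚ y → f x <ₚ f y

  Image : (OrdSum A n → OrdSum A n) → (OrdSum A n → Set a) → OrdSum A n → Set a
  Image f S z = Σ (OrdSum A n) (λ w → S w × (f w ≡ z))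

  StronglyUpperConePreserving : (OrdSum A n → OrdSum A n) → Set a
  StronglyUpperConePreserving f =
    ∀ x y → ¬ (f x ≡ f y) →
      ∀ z → (Image f (U₂ x y) z → U₂ (f x) (f y) z)
          × (U₂ (f x) (f y) z → Image f (U₂ x y) z)

-- A strictly monotone f cannot send an element of the chain into the antichain,
-- since nothing lies strictly below an element of the antichain. Restricted to
-- the finite chain, f is then a strictly monotone self-map of Fin n, hence the
-- identity. So f fixes the chain pointwise and is monotone, and the upper cone
-- U(f x, f y) with f x ≢ f y lies inside the chain, where f(U(x,y)) and
-- U(f x, f y) visibly agree.
module Submission where

open import Defs
open import Level using (lift; lower)
open import Data.Nat as ℕ using (ℕ; suc)
import Data.Nat.Properties as ℕ
open import Data.Fin using (Fin; suc; toℕ; inject₁; _<_; _≤_; _≟_)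
open import Data.Fin.Properties using (toℕ-inject₁; ≤̄⇒inject₁<; ≤fromℕ; ≤-refl; ≤-antisym; ≤∧≢⇒<; <⇒≢)
open import Data.Fin.Induction using (<-weakInduction; >-weakInduction)
open import Data.Sum using (_⊎_; inj₁; inj₂)
open import Data.Product using (∃; _,_; proj₁; proj₂)
open import Data.Empty using (⊥-elim)
open import Data.Unit using (tt)
open import Relation.Binary.Core using (_Preserves_⟶_)
open import Relation.Binary.PropositionalEquality
open import Relation.Nullary using (¬_; yes; no)

strictlyMonotone⇒inflationary : ∀ {n} {g : Fin n → Fin n} → g Preserves _<_ ⟶ _<_ → ∀ i → i ≤ g i
strictlyMonotone⇒inflationary {suc m} {g} g-mono = <-weakInduction (λ i → i ≤ g i) ℕ.z≤n step
  where
  step : ∀ i → inject₁ i ≤ g (inject₁ i) → suc i ≤ g (suc i)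
  step i hyp = subst (ℕ._< toℕ (g (suc i))) (toℕ-inject₁ i)
    (ℕ.≤-<-trans hyp (g-mono (≤̄⇒inject₁< (≤-refl {x = i}))))

strictlyMonotone⇒deflationary : ∀ {n} {g : Fin n → Fin n} → g Preserves _<_ ⟶ _<_ → ∀ i → g i ≤ i
strictlyMonotone⇒deflationary {suc m} {g} g-mono = >-weakInduction (λ i → g i ≤ i) (≤fromℕ _) step
  where
  step : ∀ i → g (suc i) ≤ suc i → g (inject₁ i) ≤ inject₁ i
  step i hyp = subst (toℕ (g (inject₁ i)) ℕ.≤_) (sym (toℕ-inject₁ i))
    (ℕ.s≤s⁻¹ (ℕ.<-≤-trans (g-mono (≤̄⇒inject₁< (≤-refl {x = i}))) hyp))

strictlyMonotone⇒≡id : ∀ {n} {g : Fin n → Fin n} → g Preserves _<_ ⟶ _<_ → ∀ i → g i ≡ i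
strictlyMonotone⇒≡id g-mono i =
  ≤-antisym (strictlyMonotone⇒deflationary g-mono i) (strictlyMonotone⇒inflationary g-mono i)

module _ {a} {A : Set a} {n : ℕ} where

  ≤ₚ-refl : (x : OrdSum A n) → x ≤ₚ x
  ≤ₚ-refl (inj₁ x) = refl
  ≤ₚ-refl (inj₂ i) = lift ≤-refl

  ≤ₚinj₁⇒≡ : ∀ {u : OrdSum A n} {c} → u ≤ₚ inj₁ c → u ≡ inj₁ c
  ≤ₚinj₁⇒≡ {inj₁ u} refl = refl

  inj₁-minimal : ∀ {u : OrdSum A n} {c} → ¬ (u <ₚ inj₁ c)
  inj₁-minimal (u≤c , u≢c) = u≢c (≤ₚinj₁⇒≡ u≤c)

  inj₂-<ₚ : ∀ {i j : Fin n} → i < j → inj₂ {A = A} i <ₚ inj₂ j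
  inj₂-<ₚ i<j = lift (ℕ.<⇒≤ i<j) , λ { refl → <⇒≢ i<j refl }

  inj₂-<ₚ⁻¹ : ∀ {i j : Fin n} → inj₂ {A = A} i <ₚ inj₂ j → i < j
  inj₂-<ₚ⁻¹ (i≤j , i≢j) = ≤∧≢⇒< (lower i≤j) (λ { refl → i≢j refl })

  ≤ₚ⇒≡⊎<ₚ : ∀ {x y : OrdSum A n} → x ≤ₚ y → x ≡ y ⊎ x <ₚ y
  ≤ₚ⇒≡⊎<ₚ {inj₁ x} {inj₁ y} refl = inj₁ refl
  ≤ₚ⇒≡⊎<ₚ {inj₁ x} {inj₂ j} x≤j = inj₂ (x≤j , λ ())
  ≤ₚ⇒≡⊎<ₚ {inj₂ i} {inj₂ j} i≤j with i ≟ j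
  ... | yes refl = inj₁ refl
  ... | no i≢j = inj₂ (i≤j , λ { refl → i≢j refl })

  module _ {f : OrdSum A n → OrdSum A n} (f-mono : StrictlyMonotone f) where

    strictlyMonotone⇒monotone : ∀ {x y} → x ≤ₚ y → f x ≤ₚ f y
    strictlyMonotone⇒monotone {x} x≤y with ≤ₚ⇒≡⊎<ₚ x≤y
    ... | inj₁ refl = ≤ₚ-refl (f x)
    ... | inj₂ x<y = proj₁ (f-mono _ _ x<y)

    maps-chain : ∀ i → ∃ λ j → f (inj₂ i) ≡ inj₂ j
    maps-chain i with f (inj₂ i) in eq
    ... | inj₂ j = j , refl
    ... | inj₁ c = ⊥-elim (inj₁-minimal
      (subst (f (inj₁ c) <ₚ_) eq (f-mono (inj₁ c) (inj₂ i) (lift tt , λ ()))))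

    fixes-chain : ∀ i → f (inj₂ i) ≡ inj₂ i
    fixes-chain i = trans (proj₂ (maps-chain i)) (cong inj₂ (strictlyMonotone⇒≡id g-mono i))
      where
      g : Fin n → Fin n
      g k = proj₁ (maps-chain k)

      g-mono : g Preserves _<_ ⟶ _<_
      g-mono {i} {j} i<j = inj₂-<ₚ⁻¹ (subst₂ _<ₚ_ (proj₂ (maps-chain i)) (proj₂ (maps-chain j))
        (f-mono (inj₂ i) (inj₂ j) (inj₂-<ₚ i<j)))

    below-chain-reflect : ∀ {x j} → f x ≤ₚ inj₂ j → x ≤ₚ inj₂ j
    below-chain-reflect {inj₁ x} _ = lift tt
    below-chain-reflect {inj₂ i} fi≤j = subst (_≤ₚ inj₂ _) (fixes-chain i) fi≤j

proposition5p1 : ∀ {a} (A : Set a) (n : ℕ) (f : OrdSum A n → OrdSum A n) →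
    StrictlyMonotone f → StronglyUpperConePreserving f
proposition5p1 A n f f-mono x y fx≢fy z = image⊆cone , cone⊆image z
  where
  image⊆cone : Image f (U₂ x y) z → U₂ (f x) (f y) z
  image⊆cone (w , (x≤w , y≤w) , refl) =
    strictlyMonotone⇒monotone f-mono x≤w , strictlyMonotone⇒monotone f-mono y≤w

  cone⊆image : ∀ z → U₂ (f x) (f y) z → Image f (U₂ x y) z
  cone⊆image (inj₁ c) (fx≤c , fy≤c) = ⊥-elim (fx≢fy (trans (≤ₚinj₁⇒≡ fx≤c) (sym (≤ₚinj₁⇒≡ fy≤c))))
  cone⊆image (inj₂ j) (fx≤j , fy≤j) =
    inj₂ j , (below-chain-reflect f-mono fx≤j , below-chain-reflect f-mono fy≤j) , fixes-chain f-mono j
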